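{- Let $\mathbb{B}$ be a complete Boolean algebra and $\mathcal{A}_{\mathbb{B}}$ the associated realizability algebra. Then $\mathsf{I}\Vdash\forall x^{\mathfrak{r}(2)}\,(x\neq\mathfrak{r}(0)\to(x\neq\mathfrak{r}(1)\to\perp))$, where $\mathsf{I}=\lambda u.u$.
   Context: Krivine realizability basics: possibly open $\lambda_c$-terms are built from variables, application $ts$, abstraction $\lambda u.t$, $\mathsf{cc}$, and continuation constants $\mathsf{k}_\pi$ ($\pi\in\Pi$); $\Lambda$ is the set of closed terms, stacks $\Pi$ are built from stack bottoms and $t\cdot\pi$; realizers are terms with no continuation constant. Names over a ZF model $\mathbf{V}$: $\mathbf{N}_\alpha=\bigcup_{\beta<\alpha}\mathcal{P}(\mathbf{N}_\beta\times\Pi)$, $\mathbf{N}=\bigcup_\alpha\mathbf{N}_\alpha$, $\mathrm{dom}(a)=\{b:\exists\pi(b,\pi)\in a\}$. Falsity values: $\|\perp\|=\Pi$, $\|a\neq b\|=\Pi$ if $a,b$ are the same set and $\emptyset$ otherwise, $\|\varphi\to\psi\|=\{t\cdot\pi:t\Vdash\varphi,\pi\in\|\psi\|\}$, restricted quantifier $\|\forall x^{c}\varphi(x)\|=\bigcup_{d\in\mathrm{dom}(c)}\|\varphi(d)\|$; $t\Vdash\varphi$ iff $t\star\pi\in\perp\!\!\!\perp$ for all $\pi\in\|\varphi\|$. Reish: $\mathfrak{r}(x)=\{(\mathfrak{r}(y),\pi):y\in x,\pi\in\Pi\}$, so $\mathrm{dom}(\mathfrak{r}(2))=\{\mathfrak{r}(0),\mathfrak{r}(1)\}$.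 The algebra $\mathcal{A}_{\mathbb{B}}$: no special instructions; stack bottoms $\omega_p$ for $p\in\mathbb{B}$. Define $\tau$: $\tau(\omega_p)=p$; $\tau(x)=\tau(\mathsf{cc})=\mathbb{1}$ for variables $x$; $\tau(t\cdot\pi)=\tau(t)\wedge\tau(\pi)$; $\tau(ts)=\tau(t)\wedge\tau(s)$; $\tau(\lambda u.t)=\tau(t)$; $\tau(\mathsf{k}_\pi)=\tau(\pi)$; $\tau(t\star\pi)=\tau(t)\wedge\tau(\pi)$. Preorder: $t\star\pi\succ s\star\sigma$ iff $\tau(t\star\pi)\le\tau(s\star\sigma)$; pole $\perp\!\!\!\perp=\{t\star\pi:\tau(t\star\pi)=\mathbb{0}\}$. -}

module Defs where

open import Level using (0ℓ)
open import Data.Nat using (ℕ; zero; suc)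
open import Data.Fin using (Fin)
open import Data.Bool using (Bool; true; false)
open import Data.Unit using (⊤; tt)
open import Data.Empty using () renaming (⊥ to Empty)
open import Data.Product using (Σ; _×_; _,_; proj₁; proj₂)
open import Relation.Binary.PropositionalEquality using (_≡_)
open import Algebra.Lattice.Bundles using (BooleanAlgebra)

record CompleteBooleanAlgebra : Set₁ where
  field
    booleanAlgebra : BooleanAlgebra 0ℓ 0ℓ
  open BooleanAlgebra booleanAlgebra public
  _≤_ : Carrier → Carrier → Set
  x ≤ y = (x ∧ y) ≈ x
  field
    ⋁       : (Carrier → Set) → Carrier
    ⋁-upper : ∀ (P : Carrier → Set) x → P x → x ≤ ⋁ P
    ⋁-least : ∀ (P : Carrier → Set) y → (∀ x → P x → x ≤ y) → ⋁ P ≤ y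

-- Sets of the ground model, Aczel-style (well-founded trees);
-- equality of sets is extensional (bisimulation).

data V : Set₁ where
  sup : (I : Set) → (I → V) → V

-- von Neumann numerals 0 = ∅, 1 = {0}, 2 = {0,1}
v0 v1 v2 : V
v0 = sup Empty (λ ())
v1 = sup ⊤ (λ _ → v0)
v2 = sup Bool (λ { false → v0 ; true → v1 })

module Realizability (𝔹 : CompleteBooleanAlgebra) where
  open CompleteBooleanAlgebra 𝔹 renaming (⊤ to 𝟙; ⊥ to 𝟘)

  -- λc-terms with n free variables (de Bruijn) and stacks.
  -- Stack bottoms are ω p for p ∈ 𝔹.
  mutual
    data Term (n : ℕ) : Set where
      var : Fin n → Term n
      app : Term n → Term n → Term n
      lam : Term (suc n) → Term n
      cc  : Term n
      k   : Stack → Term n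

    data Stack : Set where
      ω   : Carrier → Stack
      _·_ : Term 0 → Stack → Stack

  Λ : Set
  Λ = Term 0

  Π : Set
  Π = Stack

  record Process : Set where
    constructor _⋆_
    field
      term  : Λ
      stack : Π

  mutual
    NoK : ∀ {n} → Term n → Set
    NoK (var x)   = ⊤
    NoK (app t s) = NoK t × NoK s
    NoK (lam t)   = NoK t
    NoK cc        = ⊤
    NoK (k π)     = Empty

  IsRealizer : Λ → Set
  IsRealizer = NoK

  mutual
    τ : ∀ {n} → Term n → Carrier
    τ (var x)   = 𝟙
    τ (app t s) = τ t ∧ τ s
    τ (lam t)   = τ t
    τ cc        = 𝟙
    τ (k π)     = τS π

    τS : Stack → Carrier
    τS (ω p)   = p
    τS (t · π) = τ t ∧ τS π

  τP : Process → Carrier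
  τP (t ⋆ π) = τ t ∧ τS π

  _≻_ : Process → Process → Set
  p ≻ q = τP p ≤ τP q

  Pole : Process → Set
  Pole p = τP p ≈ 𝟘

  -- Names: sets of pairs (name, stack), Aczel-style.
  data Name : Set₁ where
    nm : (I : Set) → (I → Name × Π) → Name

  -- dom(a) = { b : ∃π (b,π) ∈ a } is indexed by the index type of a
  Dom : Name → Set
  Dom (nm I f) = I

  domEl : (a : Name) → Dom a → Name
  domEl (nm I f) i = proj₁ (f i)

  _≐_ : Name → Name → Set
  nm I f ≐ nm J g =
    (∀ i → Σ J λ j → (proj₁ (f i) ≐ proj₁ (g j)) × (proj₂ (f i) ≡ proj₂ (g j))) ×
    (∀ j → Σ I λ i → (proj₁ (f i) ≐ proj₁ (g j)) × (proj₂ (f i) ≡ proj₂ (g j)))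

  𝔯 : V → Name
  𝔯 (sup I f) = nm (I × Π) (λ { (i , π) → 𝔯 (f i) , π })

  data Formula : Set₁ where
    ⊥̇    : Formula
    _≠̇_  : Name → Name → Formula
    _⇒_  : Formula → Formula → Formula
    ∀̇[_] : Name → (Name → Formula) → Formula   -- restricted ∀ x^c φ(x)

  mutual
    ‖_‖ : Formula → Π → Set₁
    ‖ ⊥̇ ‖ π        = Level.Lift (Level.suc 0ℓ) ⊤
    ‖ a ≠̇ b ‖ π    = Level.Lift (Level.suc 0ℓ) (a ≐ b)
    ‖ φ ⇒ ψ ‖ π    = Σ Λ λ t → Σ Π λ σ → (π ≡ (t · σ)) × (t ⊩ φ) × ‖ ψ ‖ σ
    ‖ ∀̇[ c ] φ ‖ π = Σ (Dom c) λ d → ‖ φ (domEl c d) ‖ π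

    _⊩_ : Λ → Formula → Set₁
    t ⊩ φ = ∀ π → ‖ φ ‖ π → Level.Lift (Level.suc 0ℓ) (Pole (t ⋆ π))

  I : Λ
  I = lam (var Fin.zero)
    where import Data.Fin as Fin

  φ₁₉ : Formula
  φ₁₉ = ∀̇[ 𝔯 v2 ] (λ x → (x ≠̇ 𝔯 v0) ⇒ ((x ≠̇ 𝔯 v1) ⇒ ⊥̇))

{-# OPTIONS --safe #-}
-- In 𝒜_𝔹 a process lies in the pole exactly when the meet τ of all its
-- constituents is 𝟘. A realizer t of a ≠ a must send the stack ω 𝟙 into the
-- pole, which forces τ t ≈ 𝟘; hence every process whose stack carries such a
-- realizer is in the pole, whatever the head term. For x ∈ dom 𝔯(2) one of the
-- two hypotheses x ≠ 𝔯(0), x ≠ 𝔯(1) is of the form a ≠ a, so not only I but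
-- every closed term realizes the formula.
module Submission where

open import Defs
open import Level using (lift)
open import Data.Bool using (true; false)
open import Data.Product using (_,_; proj₁)
open import Relation.Binary.PropositionalEquality using (refl)
import Algebra.Lattice.Properties.BooleanAlgebra as BooleanAlgebraProperties

module _ (𝔹 : CompleteBooleanAlgebra) where
  open Realizability 𝔹
  open CompleteBooleanAlgebra 𝔹
    using (booleanAlgebra; _≈_; _∧_; trans; sym; ∧-congˡ; ∧-congʳ)
    renaming (⊤ to 𝟙; ⊥ to 𝟘)
  open BooleanAlgebraProperties booleanAlgebra using (∧-identityʳ; ∧-zeroˡ; ∧-zeroʳ)

  ≐-refl : ∀ a → a ≐ a
  ≐-refl (nm _ f) = (λ i → i , ≐-refl (proj₁ (f i)) , refl)
                  , (λ i → i , ≐-refl (proj₁ (f i)) , refl)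

  τ≈𝟘-of-⊩-≠-refl : ∀ t a → t ⊩ (a ≠̇ a) → τ t ≈ 𝟘
  τ≈𝟘-of-⊩-≠-refl t a t⊩a≠a with t⊩a≠a (ω 𝟙) (lift (≐-refl a))
  ... | lift t⋆ω𝟙∈⊥⊥ = trans (sym (∧-identityʳ (τ t))) t⋆ω𝟙∈⊥⊥

  τS-·-zeroˡ : ∀ t π → τ t ≈ 𝟘 → τS (t · π) ≈ 𝟘
  τS-·-zeroˡ t π τt≈𝟘 = trans (∧-congʳ τt≈𝟘) (∧-zeroˡ (τS π))

  τS-·-zeroʳ : ∀ t π → τS π ≈ 𝟘 → τS (t · π) ≈ 𝟘
  τS-·-zeroʳ t π τSπ≈𝟘 = trans (∧-congˡ τSπ≈𝟘) (∧-zeroʳ (τ t))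

  pole-of-τS≈𝟘 : ∀ u π → τS π ≈ 𝟘 → Pole (u ⋆ π)
  pole-of-τS≈𝟘 u π τSπ≈𝟘 = trans (∧-congˡ τSπ≈𝟘) (∧-zeroʳ (τ u))

  ⊩-φ₁₉ : ∀ u → u ⊩ φ₁₉
  ⊩-φ₁₉ u _ ((false , _) , t , _ , refl , t⊩r0≠r0 , s , ρ , refl , _) =
    lift (pole-of-τS≈𝟘 u (t · (s · ρ))
           (τS-·-zeroˡ t (s · ρ) (τ≈𝟘-of-⊩-≠-refl t _ t⊩r0≠r0)))
  ⊩-φ₁₉ u _ ((true , _) , t , _ , refl , _ , s , ρ , refl , s⊩r1≠r1 , _) =
    lift (pole-of-τS≈𝟘 u (t · (s · ρ))
           (τS-·-zeroʳ t (s · ρ) (τS-·-zeroˡ s ρ (τ≈𝟘-of-⊩-≠-refl s _ s⊩r1≠r1))))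

proposition19p3 : (𝔹 : CompleteBooleanAlgebra) → Realizability._⊩_ 𝔹 (Realizability.I 𝔹) (Realizability.φ₁₉ 𝔹)
proposition19p3 𝔹 = ⊩-φ₁₉ 𝔹 (Realizability.I 𝔹)
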